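{- Let $U(0)$ and $d$ be positive integers, $U(n)=U(0)+nd$, and let $(S(n))_{n\geqslant0}$ be the right-concatenation of $(U(n))_{n\geqslant0}$ (so $S(0)=U(0)$). For an integer $n\geqslant0$ put $$l=\lceil \log_{10}(n d+S(0)+1)\rceil,\qquad t_l=\left\lfloor \frac{10^{l-1}-S(0)}{d}\right\rfloor,$$ and assume $t_l\geqslant 0$ and that there are at least four indices $m\geqslant0$ such that $U(m)$ has exactly $l$ decimal digits. Let $s_0=S(t_l)$, $s_1=S(t_l+1)$, $s_2=S(t_l+2)$ and $$\alpha_l=-\frac{(10^l-1)\,U(t_l)+d\cdot 10^l}{(10^l-1)^2},\qquad \mu_l=-\frac{d}{10^l-1},\qquad \theta_l=\frac{s_2-2s_1+s_0}{(10^l-1)^2}.$$ Then $$S(n)=\alpha_l+\mu_l\,(n-t_l)+\theta_l\,10^{l(n-t_l)} .$$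
   Context: The right-concatenation of a sequence of positive integers $(U(n))_{n\geqslant0}$ is the sequence $S(n)$ whose decimal representation is the concatenation of the decimal representations of $U(0),U(1),\ldots,U(n)$ in this order; equivalently $S(0)=U(0)$ and $S(n+1)=10^{k}S(n)+U(n+1)$ where $k$ is the number of decimal digits of $U(n+1)$. Note $l$ is the number of decimal digits of $U(n)$. -}

module Defs where

open import Data.Nat using (ℕ; zero; suc; _+_; _*_; _∸_; _^_; _≤_)
open import Data.Nat.DivMod using (_/_)
open import Data.Integer using (ℤ; +_; -[1+_])
import Data.Rational as ℚ
open ℚ using (ℚ)

-- number of decimal digits of a natural number (numDigits 0 = 0);
-- the fuel argument (initially x itself) is always sufficient
numDigitsAux : ℕ → ℕ → ℕ
numDigitsAux zero    _       = 0
numDigitsAux (suc f) zero    = 0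
numDigitsAux (suc f) (suc x) = suc (numDigitsAux f (suc x / 10))

numDigits : ℕ → ℕ
numDigits x = numDigitsAux x x

rconcat : (ℕ → ℕ) → ℕ → ℕ
rconcat U zero    = U zero
rconcat U (suc n) = rconcat U n * 10 ^ numDigits (U (suc n)) + U (suc n)

arith : ℕ → ℕ → ℕ → ℕ
arith U0 d n = U0 + n * d

IsCeilLog10 : ℕ → ℕ → Set
IsCeilLog10 x l = (x ≤ 10 ^ l) Data.Product.× (∀ k → x ≤ 10 ^ k → l ≤ k)
  where import Data.Product

-- division of an integer by a natural number as a rational
-- (convention: division by 0 gives 0; only used with nonzero denominators)
_/'_ : ℤ → ℕ → ℚ
n /' zero  = ℚ.0ℚ
n /' suc k = n ℚ./ suc k

pow10 : ℤ → ℚ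
pow10 (+ k)      = (+ (10 ^ k)) ℚ./ 1
pow10 (-[1+ k ]) = (+ 1) /' (10 ^ suc k)

module Submission where

-- Put T = t_l.  By the choice of T we have U(T) ≤ 10^(l-1) < U(T+1), and the
-- choice of l gives 10^(l-1) ≤ U(n) < 10^l, so U(T+1), …, U(n) all have exactly
-- l digits; so do U(T+1) and U(T+2), because among the four l-digit terms the
-- last has index at least T+3.  On such a run S(m+1) = P·S(m) + U(m+1) with
-- P = 10^l, and this affine recurrence with arithmetic inhomogeneity solves, with
-- D = P - 1, a = D·U(T) + d·P and c = D²·S(T) + a, to
--     D²·S(T+k) + a + d·D·k = c·P^k.
-- Comparing k = 0, 1, 2 gives c = s₂ - 2s₁ + s₀, and dividing by D² in ℚ at
-- k = n - T is the claimed formula.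

open import Defs
open import Data.Nat using (ℕ; _+_; _*_; _∸_; _^_; _<_; NonZero)
open import Data.Integer using (ℤ; +_; ∣_∣) renaming (_+_ to _+ℤ_; _-_ to _-ℤ_; _*_ to _*ℤ_; _≤_ to _≤ℤ_)
open import Data.Rational using (ℚ; floor) renaming (_+_ to _+ℚ_; _*_ to _*ℚ_; -_ to -ℚ_; _/_ to _/ℚ_)
open import Data.Product using (_×_; ∃)
open import Relation.Binary.PropositionalEquality using (_≡_)

open import Data.Nat using (zero; suc; _≤_; z≤n; s≤s)
import Data.Nat.Properties as ℕ
import Data.Integer.Properties as ℤ
open import Data.Empty using (⊥-elim)
open import Data.Product using (_,_; proj₁; proj₂)
open import Relation.Binary.PropositionalEquality using (refl; sym; trans; cong; cong₂; subst; module ≡-Reasoning)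

module Digits where
  open import Data.Nat using (>-nonZero)
  open import Data.Nat.Properties
  open import Data.Nat.DivMod using (_/_; _%_; m≡m%n+[m/n]*n; m/n<m; m/n≡0⇒m<n; m%n<n)
  open import Data.Sum using (_⊎_; inj₁; inj₂)

  DecimalLength : ℕ → ℕ → Set
  DecimalLength x k = (x ≡ 0 × k ≡ 0) ⊎ ∃ λ j → k ≡ suc j × 10 ^ j ≤ x × x < 10 ^ suc j

  numDigitsAux-spec : ∀ f x → x ≤ f → DecimalLength x (numDigitsAux f x)
  numDigitsAux-spec zero    zero    _         = inj₁ (refl , refl)
  numDigitsAux-spec (suc f) zero    _         = inj₁ (refl , refl)
  numDigitsAux-spec (suc f) (suc x) (s≤s x≤f)
    with numDigitsAux-spec f (suc x / 10) (≤-trans (<⇒≤pred (m/n<m (suc x) 10 (s≤s (s≤s z≤n)))) x≤f)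
  ... | inj₁ (q≡0 , k≡0) = inj₂ (0 , cong suc k≡0 , s≤s z≤n , m/n≡0⇒m<n q≡0)
  ... | inj₂ (j , k≡1+j , lo , hi) = inj₂ (suc j , cong suc k≡1+j , lo′ , hi′)
    where
    open ≤-Reasoning
    q = suc x / 10
    r = suc x % 10
    x≡r+q*10 : suc x ≡ r + q * 10
    x≡r+q*10 = m≡m%n+[m/n]*n (suc x) 10
    lo′ : 10 ^ suc j ≤ suc x
    lo′ = begin
      10 * 10 ^ j ≤⟨ *-monoʳ-≤ 10 lo ⟩
      10 * q      ≡⟨ *-comm 10 q ⟩
      q * 10      ≤⟨ m≤n+m (q * 10) r ⟩
      r + q * 10  ≡⟨ x≡r+q*10 ⟨
      suc x       ∎
    hi′ : suc x < 10 ^ suc (suc j)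
    hi′ = begin-strict
      suc x            ≡⟨ x≡r+q*10 ⟩
      r + q * 10       <⟨ +-monoˡ-< (q * 10) (m%n<n (suc x) 10) ⟩
      10 + q * 10      ≡⟨ *-comm (suc q) 10 ⟩
      10 * suc q       ≤⟨ *-monoʳ-≤ 10 hi ⟩
      10 ^ suc (suc j) ∎

  numDigits-spec : ∀ x → DecimalLength x (numDigits x)
  numDigits-spec x = numDigitsAux-spec x x ≤-refl

  numDigits-< : ∀ x → x < 10 ^ numDigits x
  numDigits-< x with numDigits x | numDigits-spec x
  ... | _ | inj₁ (refl , refl)        = s≤s z≤n
  ... | _ | inj₂ (_ , refl , _ , hi) = hi

  numDigits-≥ : ∀ {x j} → numDigits x ≡ suc j → 10 ^ j ≤ x
  numDigits-≥ {x} eq with numDigits x | numDigits-spec x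
  numDigits-≥ ()   | _ | inj₁ (_ , refl)
  numDigits-≥ refl | _ | inj₂ (_ , refl , lo , _) = lo

  numDigits-≡ : ∀ {x j} → 10 ^ j ≤ x → x < 10 ^ suc j → numDigits x ≡ suc j
  numDigits-≡ {x} {j} lo hi with numDigits-spec x
  ... | inj₁ (refl , _)           = ⊥-elim (<⇒≱ (m^n>0 10 j) lo)
  ... | inj₂ (i , eq , lo′ , hi′) = trans eq (cong suc (≤-antisym (exponent-≤ lo′ hi) (exponent-≤ lo hi′)))
    where
    exponent-≤ : ∀ {a b} → 10 ^ a ≤ x → x < 10 ^ suc b → a ≤ b
    exponent-≤ la hb = ≮⇒≥ λ b<a → <-irrefl refl (<-≤-trans hb (≤-trans (^-monoʳ-≤ 10 b<a) la))

  ceilLog10-zero : ∀ {x} → IsCeilLog10 (suc x) 0 → x ≡ 0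
  ceilLog10-zero (s≤s x≤0 , _) = n≤0⇒n≡0 x≤0

  ceilLog10-bounds : ∀ {x l} → IsCeilLog10 (suc x) (suc l) → 10 ^ l ≤ x × x < 10 ^ suc l
  ceilLog10-bounds {x} {l} (x<10^1+l , least) = ≮⇒≥ (λ x<10^l → 1+n≰n (least l x<10^l)) , x<10^1+l

  suc[10^l∸1]≡10^l : ∀ l → suc (10 ^ l ∸ 1) ≡ 10 ^ l
  suc[10^l∸1]≡10^l l = m+[n∸m]≡n (m^n>0 10 l)

  10^[1+l]∸1-nonZero : ∀ l → NonZero (10 ^ suc l ∸ 1)
  10^[1+l]∸1-nonZero l = >-nonZero (m<n⇒0<n∸m (^-monoʳ-< 10 (s≤s (s≤s z≤n)) {0} {suc l} (s≤s z≤n)))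

open Digits

module Floor where
  import Data.Integer as ℤ
  open import Data.Integer.Properties
    using (*-cancelʳ-≤-pos; *-cancelʳ-<-nonNeg; *-monoʳ-≤-nonNeg; *-monoʳ-<-pos; *-commutativeSemigroup;
           pos-+; pos-*; +-monoʳ-≤; +-monoʳ-<; drop‿+≤+; drop‿+<+; module ≤-Reasoning)
  open import Algebra.Properties.CommutativeSemigroup *-commutativeSemigroup using (xy∙z≈xz∙y)
  open import Data.Integer.DivMod using ([n/d]*d≤n; n<s[n/ℕd]*d; div-pos-is-/ℕ)
  open import Data.Integer.Tactic.RingSolver using (solve-∀)
  open import Data.Rational using (mkℚ; toℚᵘ)
  open import Data.Rational.Properties using (toℚᵘ-fromℚᵘ)
  open import Data.Rational.Unnormalised using (mkℚᵘ; *≡*) renaming (_≃_ to _≃ᵘ_)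

  floor-cross-bounds : ∀ p z e → toℚᵘ p ≃ᵘ mkℚᵘ z e →
    floor p *ℤ + suc e ≤ℤ z × z ℤ.< ℤ.suc (floor p) *ℤ + suc e
  floor-cross-bounds (mkℚ n dm _) z e (*≡* n*s≡z*q) = lower , upper
    where
    open ≤-Reasoning
    q = + suc dm
    s = + suc e
    f = n ℤ./ q
    lower : f *ℤ s ≤ℤ z
    lower = *-cancelʳ-≤-pos (f *ℤ s) z q (begin
      f *ℤ s *ℤ q ≡⟨ xy∙z≈xz∙y f s q ⟩
      f *ℤ q *ℤ s ≤⟨ *-monoʳ-≤-nonNeg s ([n/d]*d≤n n q) ⟩
      n *ℤ s      ≡⟨ n*s≡z*q ⟩
      z *ℤ q      ∎)
    upper : z ℤ.< ℤ.suc f *ℤ s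
    upper = *-cancelʳ-<-nonNeg q (begin-strict
      z *ℤ q                          ≡⟨ n*s≡z*q ⟨
      n *ℤ s                          <⟨ *-monoʳ-<-pos s (n<s[n/ℕd]*d n (suc dm)) ⟩
      ℤ.suc (n ℤ./ℕ suc dm) *ℤ q *ℤ s ≡⟨ cong (λ g → ℤ.suc g *ℤ q *ℤ s) (div-pos-is-/ℕ n (suc dm)) ⟨
      ℤ.suc f *ℤ q *ℤ s               ≡⟨ xy∙z≈xz∙y (ℤ.suc f) q s ⟩
      ℤ.suc f *ℤ s *ℤ q               ∎)

  floor-/-bounds : ∀ z e → floor (z /ℚ suc e) *ℤ + suc e ≤ℤ z × z ℤ.< ℤ.suc (floor (z /ℚ suc e)) *ℤ + suc e
  floor-/-bounds z e = floor-cross-bounds (z /ℚ suc e) z e (toℚᵘ-fromℚᵘ (mkℚᵘ z e))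

  floor-diff-bounds : ∀ A B d .{{_ : NonZero d}} T → floor ((+ A -ℤ + B) /ℚ d) ≡ + T →
    arith B d T ≤ A × A < arith B d (suc T)
  floor-diff-bounds A B d@(suc e) T floor≡T = drop‿+≤+ lower , drop‿+<+ upper
    where
    open ≤-Reasoning
    bounds = floor-/-bounds (+ A -ℤ + B) e
    cast : ∀ m → + (B + m * d) ≡ + B +ℤ + m *ℤ + d
    cast m = trans (pos-+ B (m * d)) (cong (+ B +ℤ_) (pos-* m d))
    y+[x-y]≡x : ∀ x y → y +ℤ (x -ℤ y) ≡ x
    y+[x-y]≡x = solve-∀
    lower : + (B + T * d) ≤ℤ + A
    lower = begin
      + (B + T * d)       ≡⟨ cast T ⟩
      + B +ℤ + T *ℤ + d   ≤⟨ +-monoʳ-≤ (+ B) (subst (λ f → f *ℤ + d ≤ℤ + A -ℤ + B) floor≡T (proj₁ bounds)) ⟩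
      + B +ℤ (+ A -ℤ + B) ≡⟨ y+[x-y]≡x (+ A) (+ B) ⟩
      + A                 ∎
    upper : + A ℤ.< + (B + suc T * d)
    upper = begin-strict
      + A                   ≡⟨ y+[x-y]≡x (+ A) (+ B) ⟨
      + B +ℤ (+ A -ℤ + B)   <⟨ +-monoʳ-< (+ B) (subst (λ f → + A -ℤ + B ℤ.< ℤ.suc f *ℤ + d) floor≡T (proj₂ bounds)) ⟩
      + B +ℤ + suc T *ℤ + d ≡⟨ cast (suc T) ⟨
      + (B + suc T * d)     ∎

open Floor

module Concatenation where
  open import Data.Nat.Properties
  open import Data.Nat.Tactic.RingSolver using (solve-∀)
  import Data.Integer.Tactic.RingSolver as ℤ
  open ≡-Reasoning

  arith-mono-≤ : ∀ U0 d {m m′} → m ≤ m′ → arith U0 d m ≤ arith U0 d m′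
  arith-mono-≤ U0 d m≤m′ = +-monoʳ-≤ U0 (*-monoˡ-≤ d m≤m′)

  arith-cancel-≤ : ∀ U0 d .{{_ : NonZero d}} {m m′} → arith U0 d m ≤ arith U0 d m′ → m ≤ m′
  arith-cancel-≤ U0 d {m} {m′} le = *-cancelʳ-≤ m m′ d (+-cancelˡ-≤ U0 (m * d) (m′ * d) le)

  arith-from-first : ∀ U0 d m → arith (arith U0 d 0) d m ≡ arith U0 d m
  arith-from-first U0 d m = cong (_+ m * d) (+-identityʳ U0)

  arith-floor-index : ∀ U0 d .{{_ : NonZero d}} A T → floor ((+ A -ℤ + arith U0 d 0) /ℚ d) ≡ + T →
    A < arith U0 d (suc T) × (∀ {m} → A ≤ arith U0 d m → T ≤ m)
  arith-floor-index U0 d A T floor≡T =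
      subst (A <_) (arith-from-first U0 d (suc T)) (proj₂ bounds)
    , λ A≤U[m] → arith-cancel-≤ U0 d (≤-trans (subst (_≤ A) (arith-from-first U0 d T) (proj₁ bounds)) A≤U[m])
    where bounds = floor-diff-bounds A (arith U0 d 0) d T floor≡T

  suc-arith : ∀ U0 d n → n * d + (U0 + 0 * d) + 1 ≡ suc (U0 + n * d)
  suc-arith = solve-∀

  numDigits-arith : ∀ U0 d {l T m m′} → 10 ^ l < arith U0 d (suc T) → arith U0 d m′ < 10 ^ suc l →
    T < m → m ≤ m′ → numDigits (arith U0 d m) ≡ suc l
  numDigits-arith U0 d lo hi T<m m≤m′ =
    numDigits-≡ (<⇒≤ (<-≤-trans lo (arith-mono-≤ U0 d T<m))) (≤-<-trans (arith-mono-≤ U0 d m≤m′) hi)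

  rconcat-suc : ∀ U m {l} → numDigits (U (suc m)) ≡ l → rconcat U (suc m) ≡ rconcat U m * 10 ^ l + U (suc m)
  rconcat-suc U m refl = refl

  affine-closed-form : ∀ U0 d D P (S : ℕ → ℕ) T → suc D ≡ P →
    let a = D * arith U0 d T + d * P
        c = D * D * S T + a
    in ∀ k → (∀ j → j < k → S (suc (T + j)) ≡ S (T + j) * P + arith U0 d (suc (T + j))) →
       D * D * S (T + k) + a + d * D * k ≡ c * P ^ k
  affine-closed-form U0 d D .(suc D) S T refl zero _ rewrite +-identityʳ T = base D (S T) U0 T d
    where
    base : ∀ D x U0 T d → let a = D * (U0 + T * d) + d * suc D in D * D * x + a + d * D * 0 ≡ (D * D * x + a) * 1
    base = solve-∀
  affine-closed-form U0 d D .(suc D) S T refl (suc k) step = begin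
    D * D * S (T + suc k) + a + d * D * suc k
      ≡⟨ cong (λ m → D * D * S m + a + d * D * suc k) (+-suc T k) ⟩
    D * D * S (suc (T + k)) + a + d * D * suc k
      ≡⟨ cong (λ x → D * D * x + a + d * D * suc k) (step k ≤-refl) ⟩
    D * D * (S (T + k) * suc D + arith U0 d (suc (T + k))) + a + d * D * suc k
      ≡⟨ shift D (S (T + k)) U0 T k d ⟩
    (D * D * S (T + k) + a + d * D * k) * suc D
      ≡⟨ cong (_* suc D) (affine-closed-form U0 d D (suc D) S T refl k (λ j j<k → step j (m≤n⇒m≤1+n j<k))) ⟩
    c * suc D ^ k * suc D
      ≡⟨ *-assoc c (suc D ^ k) (suc D) ⟩
    c * (suc D ^ k * suc D)
      ≡⟨ cong (c *_) (*-comm (suc D ^ k) (suc D)) ⟩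
    c * suc D ^ suc k ∎
    where
    a = D * arith U0 d T + d * suc D
    c = D * D * S T + a
    shift : ∀ D x U0 T k d → let a = D * (U0 + T * d) + d * suc D in
      D * D * (x * suc D + (U0 + suc (T + k) * d)) + a + d * D * suc k ≡ (D * D * x + a + d * D * k) * suc D
    shift = solve-∀

  rconcat-closed-form : ∀ U0 d .{{_ : NonZero d}} l T {k m′} →
    10 ^ l < arith U0 d (suc T) → arith U0 d m′ < 10 ^ suc l → T + k ≤ m′ →
    let S = rconcat (arith U0 d)
        P = 10 ^ suc l
        D = P ∸ 1
        a = D * arith U0 d T + d * P
    in D * D * S (T + k) + a + d * D * k ≡ (D * D * S T + a) * P ^ k
  rconcat-closed-form U0 d l T {k} lo hi T+k≤m′ =
    affine-closed-form U0 d (10 ^ suc l ∸ 1) (10 ^ suc l) (rconcat (arith U0 d)) T (suc[10^l∸1]≡10^l (suc l)) k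
      λ j j<k → rconcat-suc (arith U0 d) (T + j) (numDigits-arith U0 d {l} lo hi (s≤s (m≤m+n T j))
        (≤-trans (≤-reflexive (sym (+-suc T j))) (≤-trans (+-monoʳ-≤ T j<k) T+k≤m′)))

  second-difference : ∀ D P s₀ s₁ s₂ a d .{{_ : NonZero D}} → suc D ≡ P →
    let c = D * D * s₀ + a in
    D * D * s₁ + a + d * D * 1 ≡ c * P ^ 1 →
    D * D * s₂ + a + d * D * 2 ≡ c * P ^ 2 →
    (+ s₂) -ℤ (+ 2) *ℤ (+ s₁) +ℤ (+ s₀) ≡ + c
  second-difference D .(suc D) s₀ s₁ s₂ a d refl r₁ r₂ = begin
    (+ s₂) -ℤ (+ 2) *ℤ (+ s₁) +ℤ (+ s₀)       ≡⟨ regroupℤ (+ s₂) (+ s₁) (+ s₀) ⟩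
    (+ (s₂ + s₀)) -ℤ (+ 2) *ℤ (+ s₁)          ≡⟨ cong (λ x → (+ x) -ℤ (+ 2) *ℤ (+ s₁)) ℕ-form ⟩
    (+ (2 * s₁ + c)) -ℤ (+ 2) *ℤ (+ s₁)       ≡⟨ cong (λ x → x +ℤ + c -ℤ (+ 2) *ℤ (+ s₁)) (ℤ.pos-* 2 s₁) ⟩
    (+ 2) *ℤ (+ s₁) +ℤ + c -ℤ (+ 2) *ℤ (+ s₁) ≡⟨ cancelℤ (+ s₁) (+ c) ⟩
    + c                                       ∎
    where
    c = D * D * s₀ + a
    regroupℤ : ∀ x y z → x -ℤ (+ 2) *ℤ y +ℤ z ≡ x +ℤ z -ℤ (+ 2) *ℤ y
    regroupℤ = ℤ.solve-∀
    cancelℤ : ∀ y z → (+ 2) *ℤ y +ℤ z -ℤ (+ 2) *ℤ y ≡ z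
    cancelℤ = ℤ.solve-∀
    ℕ-form : s₂ + s₀ ≡ 2 * s₁ + c
    ℕ-form = *-cancelˡ-≡ (s₂ + s₀) (2 * s₁ + c) (D * D) {{m*n≢0 D D}} (+-cancelʳ-≡ (2 * a + 2 * d * D) _ _ (begin
      D * D * (s₂ + s₀) + (2 * a + 2 * d * D)         ≡⟨ regroup₂ D s₂ s₀ a d ⟩
      (D * D * s₂ + a + d * D * 2) + (D * D * s₀ + a) ≡⟨ cong (_+ c) r₂ ⟩
      c * suc D ^ 2 + c                               ≡⟨ square D c ⟩
      2 * (c * suc D ^ 1) + D * D * c                 ≡⟨ cong (λ x → 2 * x + D * D * c) r₁ ⟨
      2 * (D * D * s₁ + a + d * D * 1) + D * D * c    ≡⟨ regroup₁ D s₁ a d c ⟩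
      D * D * (2 * s₁ + c) + (2 * a + 2 * d * D)      ∎))
      where
      regroup₂ : ∀ D s₂ s₀ a d → D * D * (s₂ + s₀) + (2 * a + 2 * d * D) ≡ (D * D * s₂ + a + d * D * 2) + (D * D * s₀ + a)
      regroup₂ = solve-∀
      -- suc D ^ 2 and suc D ^ 1 in unfolded form
      square : ∀ D x → x * (suc D * (suc D * 1)) + x ≡ 2 * (x * (suc D * 1)) + D * D * x
      square = solve-∀
      regroup₁ : ∀ D s₁ a d x → 2 * (D * D * s₁ + a + d * D * 1) + D * D * x ≡ D * D * (2 * s₁ + x) + (2 * a + 2 * d * D)
      regroup₁ = solve-∀

open Concatenation

module Rational where
  open import Level using (0ℓ)
  import Data.Integer as ℤ
  open import Data.Integer.Tactic.RingSolver using (solve-∀)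
  open import Data.Rational using (1/_; toℚᵘ; 0ℚ)
  import Data.Rational as ℚ
  open import Data.Rational.Properties
    using (+-*-commutativeRing; _≟_; *-assoc; *-identityʳ; *-inverseʳ; toℚᵘ-injective; toℚᵘ-fromℚᵘ;
           toℚᵘ-homo-+; toℚᵘ-homo-*; pos⇒nonZero; pos*pos⇒pos; normalize-pos)
  open import Data.Rational.Unnormalised using (mkℚᵘ; *≡*) renaming (_+_ to _+ᵘ_; _*_ to _*ᵘ_; _≃_ to _≃ᵘ_)
  open import Data.Rational.Unnormalised.Properties using (+-cong; *-cong; module ≃-Reasoning)
  open import Relation.Nullary.Decidable using (dec⇒maybe)
  open import Tactic.RingSolver.Core.AlmostCommutativeRing using (AlmostCommutativeRing; fromCommutativeRing)
  import Tactic.RingSolver as RingSolver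

  ℚ-ring : AlmostCommutativeRing 0ℓ 0ℓ
  ℚ-ring = fromCommutativeRing +-*-commutativeRing (λ p → dec⇒maybe (0ℚ ≟ p))

  fromℕ : ℕ → ℚ
  fromℕ n = + n /ℚ 1

  toℚᵘ-/ : ∀ z k → toℚᵘ (z /ℚ suc k) ≃ᵘ mkℚᵘ z k
  toℚᵘ-/ z k = toℚᵘ-fromℚᵘ (mkℚᵘ z k)

  fromℕ-+ : ∀ m n → fromℕ (m + n) ≡ fromℕ m +ℚ fromℕ n
  fromℕ-+ m n = toℚᵘ-injective (begin
    toℚᵘ (fromℕ (m + n))             ≈⟨ toℚᵘ-/ (+ (m + n)) 0 ⟩
    mkℚᵘ (+ (m + n)) 0               ≈⟨ *≡* (trans (cong (ℤ._* + 1) (ℤ.pos-+ m n)) (unit-denominators (+ m) (+ n))) ⟩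
    mkℚᵘ (+ m) 0 +ᵘ mkℚᵘ (+ n) 0     ≈⟨ +-cong (toℚᵘ-/ (+ m) 0) (toℚᵘ-/ (+ n) 0) ⟨
    toℚᵘ (fromℕ m) +ᵘ toℚᵘ (fromℕ n) ≈⟨ toℚᵘ-homo-+ (fromℕ m) (fromℕ n) ⟨
    toℚᵘ (fromℕ m +ℚ fromℕ n)        ∎)
    where
    open ≃-Reasoning
    unit-denominators : ∀ x y → (x ℤ.+ y) ℤ.* + 1 ≡ (x ℤ.* + 1 ℤ.+ y ℤ.* + 1) ℤ.* + 1
    unit-denominators = solve-∀

  fromℕ-* : ∀ m n → fromℕ (m * n) ≡ fromℕ m *ℚ fromℕ n
  fromℕ-* m n = toℚᵘ-injective (begin
    toℚᵘ (fromℕ (m * n))             ≈⟨ toℚᵘ-/ (+ (m * n)) 0 ⟩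
    mkℚᵘ (+ (m * n)) 0               ≈⟨ *≡* (cong (ℤ._* + 1) (ℤ.pos-* m n)) ⟩
    mkℚᵘ (+ m) 0 *ᵘ mkℚᵘ (+ n) 0     ≈⟨ *-cong (toℚᵘ-/ (+ m) 0) (toℚᵘ-/ (+ n) 0) ⟨
    toℚᵘ (fromℕ m) *ᵘ toℚᵘ (fromℕ n) ≈⟨ toℚᵘ-homo-* (fromℕ m) (fromℕ n) ⟨
    toℚᵘ (fromℕ m *ℚ fromℕ n)        ∎)
    where open ≃-Reasoning

  a/n*n≡a : ∀ a n .{{_ : NonZero n}} → (+ a /ℚ n) *ℚ fromℕ n ≡ fromℕ a
  a/n*n≡a a n@(suc k) = toℚᵘ-injective (begin
    toℚᵘ ((+ a /ℚ n) *ℚ fromℕ n)     ≈⟨ toℚᵘ-homo-* (+ a /ℚ n) (fromℕ n) ⟩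
    toℚᵘ (+ a /ℚ n) *ᵘ toℚᵘ (fromℕ n) ≈⟨ *-cong (toℚᵘ-/ (+ a) k) (toℚᵘ-/ (+ n) 0) ⟩
    mkℚᵘ (+ a) k *ᵘ mkℚᵘ (+ n) 0      ≈⟨ *≡* (trans (ℤ.*-identityʳ (+ a ℤ.* + n)) (cong (λ m → + a ℤ.* + m) (sym (ℕ.*-identityʳ n)))) ⟩
    mkℚᵘ (+ a) 0                      ≈⟨ toℚᵘ-/ (+ a) 0 ⟨
    toℚᵘ (fromℕ a)                    ∎)
    where open ≃-Reasoning

  fromℕ-pos : ∀ n .{{_ : NonZero n}} → ℚ.Positive (fromℕ n)
  fromℕ-pos n@(suc _) = normalize-pos n 1

  *-cancelʳ-≡ : ∀ p q r .{{_ : ℚ.NonZero r}} → p *ℚ r ≡ q *ℚ r → p ≡ q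
  *-cancelʳ-≡ p q r pr≡qr = trans (sym (undo p)) (trans (cong (_*ℚ 1/ r) pr≡qr) (undo q))
    where
    undo : ∀ x → x *ℚ r *ℚ 1/ r ≡ x
    undo x = trans (*-assoc x r (1/ r)) (trans (cong (x *ℚ_) (*-inverseʳ r)) (*-identityʳ x))

  rational-form : ∀ D x a d c K Q .{{_ : NonZero D}} → D * D * x + a + d * D * K ≡ c * Q →
    fromℕ x ≡ -ℚ ((+ a) /' (D * D)) +ℚ -ℚ ((+ d) /' D) *ℚ fromℕ K +ℚ ((+ c) /' (D * D)) *ℚ fromℕ Q
  rational-form D@(suc _) x a d c K Q eq = *-cancelʳ-≡ _ _ (e *ℚ e) (begin
    fromℕ x *ℚ (e *ℚ e)
      ≡⟨ isolate (fromℕ x) (fromℕ a) (fromℕ d) e (fromℕ K) ⟩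
    -ℚ fromℕ a +ℚ -ℚ (fromℕ d *ℚ e *ℚ fromℕ K) +ℚ (e *ℚ e *ℚ fromℕ x +ℚ fromℕ a +ℚ fromℕ d *ℚ e *ℚ fromℕ K)
      ≡⟨ cong (-ℚ fromℕ a +ℚ -ℚ (fromℕ d *ℚ e *ℚ fromℕ K) +ℚ_) lifted ⟩
    -ℚ fromℕ a +ℚ -ℚ (fromℕ d *ℚ e *ℚ fromℕ K) +ℚ fromℕ c *ℚ fromℕ Q
      ≡⟨ cong₂ (λ u v → -ℚ u +ℚ -ℚ (v *ℚ e *ℚ fromℕ K) +ℚ fromℕ c *ℚ fromℕ Q) (sym (cancel-D² a)) (sym (a/n*n≡a d D)) ⟩
    -ℚ (A *ℚ (e *ℚ e)) +ℚ -ℚ (B *ℚ e *ℚ e *ℚ fromℕ K) +ℚ fromℕ c *ℚ fromℕ Q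
      ≡⟨ cong (λ w → -ℚ (A *ℚ (e *ℚ e)) +ℚ -ℚ (B *ℚ e *ℚ e *ℚ fromℕ K) +ℚ w *ℚ fromℕ Q) (sym (cancel-D² c)) ⟩
    -ℚ (A *ℚ (e *ℚ e)) +ℚ -ℚ (B *ℚ e *ℚ e *ℚ fromℕ K) +ℚ C *ℚ (e *ℚ e) *ℚ fromℕ Q
      ≡⟨ factor A B C e (fromℕ K) (fromℕ Q) ⟩
    (-ℚ A +ℚ -ℚ B *ℚ fromℕ K +ℚ C *ℚ fromℕ Q) *ℚ (e *ℚ e) ∎)
    where
    open ≡-Reasoning
    e = fromℕ D
    instance
      e-pos : ℚ.Positive e
      e-pos = fromℕ-pos D
      e²-nonZero : ℚ.NonZero (e *ℚ e)
      e²-nonZero = pos⇒nonZero (e *ℚ e) {{pos*pos⇒pos e e}}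
    A = + a /ℚ (D * D)
    B = + d /ℚ D
    C = + c /ℚ (D * D)
    cancel-D² : ∀ m → (+ m /ℚ (D * D)) *ℚ (e *ℚ e) ≡ fromℕ m
    cancel-D² m = trans (cong ((+ m /ℚ (D * D)) *ℚ_) (sym (fromℕ-* D D))) (a/n*n≡a m (D * D))
    lifted : e *ℚ e *ℚ fromℕ x +ℚ fromℕ a +ℚ fromℕ d *ℚ e *ℚ fromℕ K ≡ fromℕ c *ℚ fromℕ Q
    lifted = begin
      e *ℚ e *ℚ fromℕ x +ℚ fromℕ a +ℚ fromℕ d *ℚ e *ℚ fromℕ K
        ≡⟨ cong₂ (λ u v → u *ℚ fromℕ x +ℚ fromℕ a +ℚ v *ℚ fromℕ K) (fromℕ-* D D) (fromℕ-* d D) ⟨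
      fromℕ (D * D) *ℚ fromℕ x +ℚ fromℕ a +ℚ fromℕ (d * D) *ℚ fromℕ K
        ≡⟨ cong₂ (λ u v → u +ℚ fromℕ a +ℚ v) (fromℕ-* (D * D) x) (fromℕ-* (d * D) K) ⟨
      fromℕ (D * D * x) +ℚ fromℕ a +ℚ fromℕ (d * D * K)
        ≡⟨ cong (_+ℚ fromℕ (d * D * K)) (fromℕ-+ (D * D * x) a) ⟨
      fromℕ (D * D * x + a) +ℚ fromℕ (d * D * K)
        ≡⟨ fromℕ-+ (D * D * x + a) (d * D * K) ⟨
      fromℕ (D * D * x + a + d * D * K)
        ≡⟨ cong fromℕ eq ⟩
      fromℕ (c * Q)
        ≡⟨ fromℕ-* c Q ⟩
      fromℕ c *ℚ fromℕ Q ∎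
    isolate : ∀ x a d e k → x *ℚ (e *ℚ e) ≡ -ℚ a +ℚ -ℚ (d *ℚ e *ℚ k) +ℚ (e *ℚ e *ℚ x +ℚ a +ℚ d *ℚ e *ℚ k)
    isolate = RingSolver.solve-∀ ℚ-ring
    factor : ∀ A B C e k q → -ℚ (A *ℚ (e *ℚ e)) +ℚ -ℚ (B *ℚ e *ℚ e *ℚ k) +ℚ C *ℚ (e *ℚ e) *ℚ q ≡ (-ℚ A +ℚ -ℚ B *ℚ k +ℚ C *ℚ q) *ℚ (e *ℚ e)
    factor = RingSolver.solve-∀ ℚ-ring

  exponential-form : ∀ D x a d c (θ k : ℤ) K l .{{_ : NonZero D}} →
    θ ≡ + c → k ≡ + K → D * D * x + a + d * D * K ≡ c * 10 ^ (l * K) →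
    fromℕ x ≡ -ℚ ((+ a) /' (D * D)) +ℚ -ℚ ((+ d) /' D) *ℚ (k /ℚ 1) +ℚ (θ /' (D * D)) *ℚ pow10 ((+ l) *ℤ k)
  exponential-form D x a d c _ _ K l refl refl key rewrite sym (ℤ.pos-* l K) =
    rational-form D x a d c K (10 ^ (l * K)) key

open Rational

theorem1 : (U0 d : ℕ) → 0 < U0 → .{{_ : NonZero d}} → (n l : ℕ) →
  IsCeilLog10 (n * d + rconcat (arith U0 d) 0 + 1) l →
  let U = arith U0 d
      S = rconcat U
      tl : ℤ
      tl = floor (((+ (10 ^ (l ∸ 1))) -ℤ (+ S 0)) /ℚ d)
  in (+ 0 ≤ℤ tl) →
  (∃ λ m₁ → ∃ λ m₂ → ∃ λ m₃ → ∃ λ m₄ →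
     m₁ < m₂ × m₂ < m₃ × m₃ < m₄ ×
     numDigits (U m₁) ≡ l × numDigits (U m₂) ≡ l ×
     numDigits (U m₃) ≡ l × numDigits (U m₄) ≡ l) →
  let t  = ∣ tl ∣
      s₀ = S t
      s₁ = S (t + 1)
      s₂ = S (t + 2)
      D  = 10 ^ l ∸ 1
      αl = -ℚ ((+ (D * U t + d * 10 ^ l)) /' (D * D))
      μl = -ℚ ((+ d) /' D)
      θl = ((+ s₂) -ℤ (+ 2) *ℤ (+ s₁) +ℤ (+ s₀)) /' (D * D)
      k  = (+ n) -ℤ tl
  in ((+ S n) /ℚ 1) ≡ αl +ℚ μl *ℚ (k /ℚ 1) +ℚ θl *ℚ pow10 ((+ l) *ℤ k)
theorem1 U0 d U0>0 n zero ceil _ _ =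
  ⊥-elim (ℕ.n≮0 (ℕ.<-≤-trans U0>0 (ℕ.≤-trans (ℕ.m≤m+n U0 (n * d)) (ℕ.≤-reflexive U[n]≡0))))
  where
  U[n]≡0 : U0 + n * d ≡ 0
  U[n]≡0 = ceilLog10-zero (subst (λ x → IsCeilLog10 x 0) (suc-arith U0 d n) ceil)
theorem1 U0 d U0>0 n l@(suc l′) ceil 0≤tl (m₁ , m₂ , m₃ , m₄ , m₁<m₂ , m₂<m₃ , m₃<m₄ , #U[m₁] , _ , _ , #U[m₄]) =
  exponential-form D (S n) a d c _ _ K l θ≡c n-tl≡K key
  where
  U = arith U0 d
  S = rconcat U
  tl = floor (((+ (10 ^ l′)) -ℤ (+ S 0)) /ℚ d)
  T = ∣ tl ∣
  tl≡T : tl ≡ + T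
  tl≡T = sym (ℤ.0≤i⇒+∣i∣≡i 0≤tl)
  D = 10 ^ l ∸ 1
  instance
    D-nonZero : NonZero D
    D-nonZero = 10^[1+l]∸1-nonZero l′
  a = D * U T + d * 10 ^ l
  c = D * D * S T + a
  K = n ∸ T
  10^l′<U[1+T] : 10 ^ l′ < U (suc T)
  10^l′<U[1+T] = proj₁ (arith-floor-index U0 d (10 ^ l′) T tl≡T)
  T≤ : ∀ {m} → 10 ^ l′ ≤ U m → T ≤ m
  T≤ = proj₂ (arith-floor-index U0 d (10 ^ l′) T tl≡T)
  n-bounds : 10 ^ l′ ≤ U n × U n < 10 ^ l
  n-bounds = ceilLog10-bounds (subst (λ x → IsCeilLog10 x l) (suc-arith U0 d n) ceil)
  T≤n : T ≤ n
  T≤n = T≤ (proj₁ n-bounds)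
  T+2≤m₄ : T + 2 ≤ m₄
  T+2≤m₄ = begin
    T + 2  ≡⟨ ℕ.+-comm T 2 ⟩
    2 + T  ≤⟨ s≤s (s≤s (T≤ (numDigits-≥ #U[m₁]))) ⟩
    2 + m₁ ≤⟨ s≤s m₁<m₂ ⟩
    suc m₂ ≤⟨ m₂<m₃ ⟩
    m₃     <⟨ m₃<m₄ ⟩
    m₄     ∎
    where open ℕ.≤-Reasoning
  closed-before-m₄ : ∀ {k} → T + k ≤ m₄ → D * D * S (T + k) + a + d * D * k ≡ c * (10 ^ l) ^ k
  closed-before-m₄ = rconcat-closed-form U0 d l′ T 10^l′<U[1+T] (subst (λ k → U m₄ < 10 ^ k) #U[m₄] (numDigits-< (U m₄)))
  key : D * D * S n + a + d * D * K ≡ c * 10 ^ (l * K)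
  key = begin
    D * D * S n + a + d * D * K       ≡⟨ cong (λ m → D * D * S m + a + d * D * K) (ℕ.m+[n∸m]≡n T≤n) ⟨
    D * D * S (T + K) + a + d * D * K ≡⟨ rconcat-closed-form U0 d l′ T 10^l′<U[1+T] (proj₂ n-bounds) (ℕ.≤-reflexive (ℕ.m+[n∸m]≡n T≤n)) ⟩
    c * (10 ^ l) ^ K                  ≡⟨ cong (c *_) (ℕ.^-*-assoc 10 l K) ⟩
    c * 10 ^ (l * K)                  ∎
    where open ≡-Reasoning
  θ≡c : (+ S (T + 2)) -ℤ (+ 2) *ℤ (+ S (T + 1)) +ℤ (+ S T) ≡ + c
  θ≡c = second-difference D (10 ^ l) (S T) (S (T + 1)) (S (T + 2)) a d (suc[10^l∸1]≡10^l l)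
    (closed-before-m₄ (ℕ.≤-trans (ℕ.+-monoʳ-≤ T (s≤s z≤n)) T+2≤m₄)) (closed-before-m₄ T+2≤m₄)
  n-tl≡K : (+ n) -ℤ tl ≡ + K
  n-tl≡K = trans (cong ((+ n) -ℤ_) tl≡T) (trans (ℤ.[+m]-[+n]≡m⊖n n T) (ℤ.≤-⊖ T≤n))
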